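{- Let $\mathcal{M}$ be a Markov automaton and $\delta>0$. For every finite path $\pi$ of $\mathcal{M}$, $T(\pi)\le\#ds(\pi)\cdot\delta$.
   Context: A Markov automaton has finite state set $S=PS\,\dot\cup\,MS$ of probabilistic states (with action-labelled transitions) and Markovian states (with one rate-labelled transition). A finite path $\pi=s_0\xrightarrow{\kappa_0}s_1\cdots s_n$ carries at each $s_i\in PS$ an action $\kappa_i$ (with $t(\kappa_i)=0$, $\alpha(\kappa_i)=\kappa_i$) and at each $s_i\in MS$ a sojourn time $\kappa_i\in\mathbb{R}_{\ge0}$ (with $t(\kappa_i)=\kappa_i$, $\alpha(\kappa_i)=\bot$); its duration is $T(\pi)=\sum_{i<n}t(\kappa_i)$. The digitization of $\pi$ w.r.t. $\delta$ is $\mathrm{di}(\pi)=(s_0\xrightarrow{\alpha(\kappa_0)})^{k_0}s_0\xrightarrow{\alpha(\kappa_0)}(s_1\xrightarrow{\alpha(\kappa_1)})^{k_1}s_1\cdots s_n$ with $k_i=\max\{k\in\mathbb{N}\mid k\delta\le t(\kappa_i)\}$. For a path $\bar\pi$ of this form, $\#ds(\bar\pi)$ is the number of positions $i<|\bar\pi|$ whose state is in $MS$, and for a finite path $\pi$ of the automaton $\#ds(\pi)=\#ds(\mathrm{di}(\pi))$. -}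

module Defs where

open import Level using (0ℓ)
open import Data.Nat using (ℕ; zero; suc) renaming (_≤_ to _≤ℕ_)
open import Data.Bool using (Bool; true; false; if_then_else_)
open import Data.Fin using (Fin)
open import Data.Maybe using (Maybe; just; nothing)
open import Data.List using (List; []; _∷_; _++_; replicate)
open import Data.Product using (Σ; ∃; _×_; _,_; proj₁; proj₂)
open import Relation.Binary.PropositionalEquality using (_≡_; _≢_)
open import Relation.Nullary using (¬_)
open import Algebra.Structures using (IsCommutativeRing)
open import Relation.Binary.Structures using (IsTotalOrder)

-- The real numbers, axiomatised as a complete ordered field
-- (any model of this record is isomorphic to ℝ).

record RealField : Set₁ where
  infixl 6 _+_
  infixl 7 _*_
  infix 4 _≤_ _<_
  field
    Carrier : Set
    _+_ _*_ : Carrier → Carrier → Carrier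
    -_      : Carrier → Carrier
    0# 1#   : Carrier
    _≤_     : Carrier → Carrier → Set
    isCommutativeRing : IsCommutativeRing _≡_ _+_ _*_ -_ 0# 1#
    isTotalOrder      : IsTotalOrder _≡_ _≤_
    0≢1      : 0# ≢ 1#
    inverse  : ∀ x → x ≢ 0# → Σ Carrier λ y → x * y ≡ 1#
    +-mono-≤ : ∀ {x y} z → x ≤ y → x + z ≤ y + z
    *-nonneg : ∀ {x y} → 0# ≤ x → 0# ≤ y → 0# ≤ x * y
    sup : (P : Carrier → Set) → (∃ λ x → P x) →
          (∃ λ b → ∀ x → P x → x ≤ b) →
          Σ Carrier λ s → (∀ x → P x → x ≤ s) ×
                          (∀ b → (∀ x → P x → x ≤ b) → s ≤ b)

  _<_ : Carrier → Carrier → Set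
  x < y = x ≤ y × x ≢ y

  _·_ : ℕ → Carrier → Carrier
  zero  · x = 0#
  suc n · x = x + n · x

record MarkovAutomaton (R : RealField) : Set₁ where
  open RealField R
  field
    n         : ℕ
    Act       : Set
    markovian : Fin n → Bool      -- true: s ∈ MS, false: s ∈ PS
    -- probabilistic transitions of PS states: P s a s' (0 if a not enabled)
    P         : Fin n → Act → Fin n → Carrier
    -- the single rate-labelled transition of MS states: rate and branching
    rate      : Fin n → Carrier
    Pm        : Fin n → Fin n → Carrier
    P-nonneg  : ∀ s a s' → 0# ≤ P s a s'
    Pm-nonneg : ∀ s s' → 0# ≤ Pm s s'
    rate-pos  : ∀ s → markovian s ≡ true → 0# < rate s

  State : Set
  State = Fin n

  data Path : State → Set where
    end   : ∀ {s} → Path s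
    pstep : ∀ {s} → markovian s ≡ false → (a : Act) → (s' : State) →
            0# < P s a s' → Path s' → Path s
    mstep : ∀ {s} → markovian s ≡ true → (t : Carrier) → 0# ≤ t →
            (s' : State) → 0# < Pm s s' → Path s' → Path s

  T : ∀ {s} → Path s → Carrier
  T end                  = 0#
  T (pstep _ _ _ _ π)    = T π
  T (mstep _ t _ _ _ π)  = t + T π

  IsMaxMult : Carrier → Carrier → ℕ → Set
  IsMaxMult δ t k = (k · δ ≤ t) × (∀ k' → k' · δ ≤ t → k' ≤ℕ k)

  -- digitized path: list of positions (state, label; nothing = ⊥)
  -- together with the final state. fl t stands for max{k | k δ ≤ t}.
  di : (fl : Carrier → ℕ) → ∀ {s} → Path s → List (State × Maybe Act) × State
  di fl {s} end = [] , s
  di fl {s} (pstep _ a _ _ π) =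
    (replicate (fl 0#) (s , just a) ++ ((s , just a) ∷ proj₁ (di fl π))) , proj₂ (di fl π)
  di fl {s} (mstep _ t _ _ _ π) =
    (replicate (fl t) (s , nothing) ++ ((s , nothing) ∷ proj₁ (di fl π))) , proj₂ (di fl π)

  countMS : List (State × Maybe Act) → ℕ
  countMS [] = zero
  countMS ((s , _) ∷ xs) = if markovian s then suc (countMS xs) else countMS xs

  #ds : (fl : Carrier → ℕ) → ∀ {s} → Path s → ℕ
  #ds fl π = countMS (proj₁ (di fl π))

module Submission where

open import Defs
open import Data.Nat using (ℕ; zero; suc) renaming (_+_ to _+ℕ_; _≤_ to _≤ℕ_)
open import Data.Nat.Properties using (+-suc; n≮n)
open import Data.Bool using (true; false)
open import Data.Maybe using (Maybe; just; nothing)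
open import Data.List using (_∷_; _++_; replicate)
open import Data.Product using (_,_; proj₁; proj₂)
open import Data.Sum using (inj₁; inj₂)
open import Data.Empty using (⊥-elim)
open import Relation.Binary.PropositionalEquality using (_≡_; refl; sym; cong; subst₂; module ≡-Reasoning)
open import Algebra.Structures using (IsCommutativeRing)
open import Relation.Binary.Structures using (IsTotalOrder)

module OrderedFieldProperties (R : RealField) where
  open RealField R
  open IsCommutativeRing isCommutativeRing using (+-identityˡ; +-assoc; +-comm)
  open IsTotalOrder isTotalOrder using (trans; total)

  ·-distribʳ-+ : ∀ m n x → (m +ℕ n) · x ≡ m · x + n · x
  ·-distribʳ-+ zero    n x = sym (+-identityˡ (n · x))
  ·-distribʳ-+ (suc m) n x = begin
    x + (m +ℕ n) · x     ≡⟨ cong (x +_) (·-distribʳ-+ m n x) ⟩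
    x + (m · x + n · x)  ≡⟨ sym (+-assoc x (m · x) (n · x)) ⟩
    x + m · x + n · x    ∎
    where open ≡-Reasoning

  +-mono-≤₂ : ∀ {a b c d} → a ≤ b → c ≤ d → a + c ≤ b + d
  +-mono-≤₂ {a} {b} {c} {d} a≤b c≤d = trans (+-mono-≤ c a≤b)
    (subst₂ _≤_ (+-comm c b) (+-comm d b) (+-mono-≤ b c≤d))

  ≤-suc-maxMult : ∀ {δ t k} → (∀ k' → k' · δ ≤ t → k' ≤ℕ k) → t ≤ suc k · δ
  ≤-suc-maxMult {δ} {t} {k} maximal with total t (suc k · δ)
  ... | inj₁ t≤ = t≤
  ... | inj₂ ≤t = ⊥-elim (n≮n k (maximal (suc k) ≤t))

module DigitizationProperties (R : RealField) (M : MarkovAutomaton R) where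
  open RealField R
  open MarkovAutomaton M
  open OrderedFieldProperties R
  open IsTotalOrder isTotalOrder using () renaming (refl to ≤-refl)

  countMS-replicate-markovian : ∀ {s} → markovian s ≡ true →
    ∀ k (x : Maybe Act) ys → countMS (replicate k (s , x) ++ ys) ≡ k +ℕ countMS ys
  countMS-replicate-markovian s∈MS zero    x ys = refl
  countMS-replicate-markovian s∈MS (suc k) x ys rewrite s∈MS =
    cong suc (countMS-replicate-markovian s∈MS k x ys)

  countMS-replicate-probabilistic : ∀ {s} → markovian s ≡ false →
    ∀ k (x : Maybe Act) ys → countMS (replicate k (s , x) ++ ys) ≡ countMS ys
  countMS-replicate-probabilistic s∈PS zero    x ys = refl
  countMS-replicate-probabilistic s∈PS (suc k) x ys rewrite s∈PS =
    countMS-replicate-probabilistic s∈PS k x ys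

  module _ (fl : Carrier → ℕ) where

    #ds-pstep : ∀ {s} (s∈PS : markovian s ≡ false) a s' p (π : Path s') →
                #ds fl (pstep s∈PS a s' p π) ≡ #ds fl π
    #ds-pstep {s} s∈PS a s' p π
      rewrite countMS-replicate-probabilistic s∈PS (fl 0#) (just a) ((s , just a) ∷ proj₁ (di fl π))
            | s∈PS = refl

    #ds-mstep : ∀ {s} (s∈MS : markovian s ≡ true) t t≥0 s' p (π : Path s') →
                #ds fl (mstep s∈MS t t≥0 s' p π) ≡ suc (fl t) +ℕ #ds fl π
    #ds-mstep {s} s∈MS t t≥0 s' p π
      rewrite countMS-replicate-markovian s∈MS (fl t) nothing ((s , nothing) ∷ proj₁ (di fl π))
            | s∈MS = +-suc (fl t) (#ds fl π)

    -- Each sojourn t is covered by the fl t + 1 digitization steps it contributes.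
    T≤#ds·δ : ∀ {δ} → (∀ t → 0# ≤ t → IsMaxMult δ t (fl t)) →
              ∀ {s} (π : Path s) → T π ≤ #ds fl π · δ
    T≤#ds·δ maxMult end = ≤-refl
    T≤#ds·δ maxMult (pstep s∈PS a s' p π)
      rewrite #ds-pstep s∈PS a s' p π = T≤#ds·δ maxMult π
    T≤#ds·δ {δ} maxMult (mstep s∈MS t t≥0 s' p π)
      rewrite #ds-mstep s∈MS t t≥0 s' p π | ·-distribʳ-+ (suc (fl t)) (#ds fl π) δ =
      +-mono-≤₂ (≤-suc-maxMult (proj₂ (maxMult t t≥0))) (T≤#ds·δ maxMult π)

lemma5 : (R : RealField) → (M : MarkovAutomaton R) →
    (δ : RealField.Carrier R) → RealField._<_ R (RealField.0# R) δ →
    (fl : RealField.Carrier R → ℕ) →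
    (∀ t → RealField._≤_ R (RealField.0# R) t → MarkovAutomaton.IsMaxMult M δ t (fl t)) →
    ∀ {s} (π : MarkovAutomaton.Path M s) →
    RealField._≤_ R (MarkovAutomaton.T M π) (RealField._·_ R (MarkovAutomaton.#ds M fl π) δ)
lemma5 R M δ _ fl maxMult π = DigitizationProperties.T≤#ds·δ R M fl maxMult π
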